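{- Let $\Pi$ be a ground program with atom set $\mathcal{A}$ and $A\subseteq\mathcal{A}$. Suppose $\hat I\in AS(\mathit{omit}(\Pi,A))$ is spurious and $PB\subseteq A$ is a put-back set for $\hat I$. Then for every $A'\subseteq A\setminus PB$ and every answer set $\hat I'\in AS(\mathit{omit}(\Pi,A\setminus(PB\cup A')))$ it holds that $\hat I'|_{\overline{A}}\neq\hat I$.
   Context: Ground programs consist of rules $\alpha_0 \leftarrow \alpha_1,\dots,\alpha_m,\mathit{not}\ \alpha_{m+1},\dots,\mathit{not}\ \alpha_n$ with $\alpha_0$ an atom or $\bot$ (constraint), possibly with choice rules $\{\alpha\}\leftarrow B$ (abbreviating $\alpha\leftarrow B,\mathit{not}\ \bar\alpha$ and $\bar\alpha\leftarrow B,\mathit{not}\ \alpha$ with fresh $\bar\alpha$, projected away from answer sets). $H(r)$, $B^+(r)$, $B^-(r)$, $B^\pm(r)=B^+(r)\cup B^-(r)$, $B(r)$ denote head, positive body, negative body, all body atoms, and body. $I$ is an answer set of $\Pi$ iff $I$ is a $\subseteq$-minimal model of $\{r\in\Pi\mid I\models B(r)\}$; $AS(\Pi)$ is the set of answer sets. For $A\subseteq\mathcal{A}$, $\mathit{omit}(r,A)$ is $r$ if $A\cap B^\pm(r)=\emptyset$ and $H(r)\notin A$; is $\{H(r)\}\leftarrow B^+(r)\setminus A,\mathit{not}\ (B^-(r)\setminus A)$ if $A\cap B^\pm(r)\neq\emptyset$ and $H(r)\notin A\cup\{\bot\}$; and is no rule otherwise (choice rules treated analogously). $\mathit{omit}(\Pi,A)=\bigcup_{r\in\Pi}\mathit{omit}(r,A)$.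 $\overline{A}=\mathcal{A}\setminus A$, $I|_{\overline{A}}=I\cap\overline{A}$. An answer set $\hat I$ of $\mathit{omit}(\Pi,A)$ is spurious if there is no $I\in AS(\Pi)$ with $I|_{\overline{A}}=\hat I$. For a spurious $\hat I\in AS(\mathit{omit}(\Pi,A))$, a put-back set is any $PB\subseteq A$ such that no answer set $\hat J$ of $\mathit{omit}(\Pi,A\setminus PB)$ satisfies $\hat J|_{\overline{A}}=\hat I$. -}

module Defs where

open import Data.Nat using (ℕ; suc)
open import Data.Fin using (Fin)
open import Data.Bool using (Bool; true; false; T; not; _∧_; _∨_)
open import Data.Maybe using (Maybe; just; nothing)
open import Data.List using (List; []; _∷_; _++_; map; filter; concatMap)
open import Data.List.Relation.Unary.All using (All)
open import Data.List.Relation.Unary.Any using (Any)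
open import Data.Sum using (_⊎_; inj₁; inj₂)
open import Data.Product using (Σ; _×_; ∃)
open import Relation.Nullary using (¬_; Dec; yes; no)
open import Relation.Nullary.Decidable using (T?)
open import Relation.Binary.PropositionalEquality using (_≡_)

ASet : Set → Set
ASet X = X → Bool

_∈ˢ_ : {X : Set} → X → ASet X → Set
a ∈ˢ S = T (S a)

_⊆ˢ_ : {X : Set} → ASet X → ASet X → Set
S ⊆ˢ S' = ∀ a → a ∈ˢ S → a ∈ˢ S'

_∖ˢ_ : {X : Set} → ASet X → ASet X → ASet X
(S ∖ˢ S') a = S a ∧ not (S' a)

_∪ˢ_ : {X : Set} → ASet X → ASet X → ASet X
(S ∪ˢ S') a = S a ∨ S' a

-- I|_{Ā} , the restriction of I to the complement of A
restrict : {X : Set} → ASet X → ASet X → ASet X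
restrict I A = I ∖ˢ A

_≐_ : {X : Set} → ASet X → ASet X → Set
S ≐ S' = ∀ a → S a ≡ S' a

data Head (n : ℕ) : Set where
  atom : Fin n → Head n
  bot  : Head n

data Rule (n : ℕ) : Set where
  normal : (h : Head n) (pos neg : List (Fin n)) → Rule n
  choice : (a : Fin n)  (pos neg : List (Fin n)) → Rule n

Program : ℕ → Set
Program n = List (Rule n)

-- Normal rules over an arbitrary atom type (used after expanding choice
-- rules with fresh atoms). nothing = ⊥.

record NRule (X : Set) : Set where
  constructor mkN
  field
    head : Maybe X
    pos  : List X
    neg  : List X
open NRule public

BodyTrue : {X : Set} → ASet X → NRule X → Set
BodyTrue I r = All (λ a → a ∈ˢ I) (pos r) × All (λ a → ¬ (a ∈ˢ I)) (neg r)

HeadTrue : {X : Set} → ASet X → Maybe X → Set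
HeadTrue I (just a) = a ∈ˢ I
HeadTrue I nothing  = Data.Empty.⊥
  where import Data.Empty

SatRule : {X : Set} → ASet X → NRule X → Set
SatRule I r = BodyTrue I r → HeadTrue I (head r)

Model : {X : Set} → ASet X → List (NRule X) → Set
Model I P = All (SatRule I) P

-- I is a ⊆-minimal model of { r ∈ P | I ⊨ B(r) }
-- (the reduct is a sub-list of P, expressed by guarding each rule).
FLPReductModel : {X : Set} → ASet X → ASet X → List (NRule X) → Set
FLPReductModel I J P = All (λ r → BodyTrue I r → SatRule J r) P

IsAnswerSetN : {X : Set} → List (NRule X) → ASet X → Set
IsAnswerSetN P I =
  FLPReductModel I I P ×
  (∀ (J : ASet _) → J ⊆ˢ I → FLPReductModel I J P → I ⊆ˢ J)

-- Expansion of choice rules: the choice rule at position i of the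
-- program, {α} ← B, becomes  α ← B, not ᾱ  and  ᾱ ← B, not α  where the
-- fresh atom ᾱ is inj₂ i.

XAtom : ℕ → Set
XAtom n = Fin n ⊎ ℕ

expandRule : {n : ℕ} → ℕ → Rule n → List (NRule (XAtom n))
expandRule i (normal (atom a) pos neg) =
  mkN (just (inj₁ a)) (map inj₁ pos) (map inj₁ neg) ∷ []
expandRule i (normal bot pos neg) =
  mkN nothing (map inj₁ pos) (map inj₁ neg) ∷ []
expandRule i (choice a pos neg) =
  mkN (just (inj₁ a)) (map inj₁ pos) (inj₂ i ∷ map inj₁ neg) ∷
  mkN (just (inj₂ i)) (map inj₁ pos) (inj₁ a ∷ map inj₁ neg) ∷ []

expandFrom : {n : ℕ} → ℕ → Program n → List (NRule (XAtom n))
expandFrom i [] = []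
expandFrom i (r ∷ Π) = expandRule i r ++ expandFrom (suc i) Π

expand : {n : ℕ} → Program n → List (NRule (XAtom n))
expand = expandFrom 0

-- I ∈ AS(Π): I is the projection onto 𝒜 of an answer set of the
-- expanded program (fresh atoms projected away).
IsAnswerSet : {n : ℕ} → Program n → ASet (Fin n) → Set
IsAnswerSet Π I =
  Σ (ASet (XAtom _)) λ J → IsAnswerSetN (expand Π) J × (∀ a → J (inj₁ a) ≡ I a)

anyIn : {n : ℕ} → ASet (Fin n) → List (Fin n) → Bool
anyIn A [] = false
anyIn A (a ∷ as) = A a ∨ anyIn A as

drop : {n : ℕ} → ASet (Fin n) → List (Fin n) → List (Fin n)
drop A = filter (λ a → T? (not (A a)))

omitRule : {n : ℕ} → Rule n → ASet (Fin n) → List (Rule n)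
omitRule (normal bot pos neg) A with anyIn A (pos ++ neg)
... | false = normal bot pos neg ∷ []
... | true  = []
omitRule (normal (atom h) pos neg) A with A h | anyIn A (pos ++ neg)
... | true  | _     = []
... | false | false = normal (atom h) pos neg ∷ []
... | false | true  = choice h (drop A pos) (drop A neg) ∷ []
omitRule (choice h pos neg) A with A h | anyIn A (pos ++ neg)
... | true  | _     = []
... | false | false = choice h pos neg ∷ []
... | false | true  = choice h (drop A pos) (drop A neg) ∷ []

omit : {n : ℕ} → Program n → ASet (Fin n) → Program n
omit Π A = concatMap (λ r → omitRule r A) Π

Spurious : {n : ℕ} → Program n → ASet (Fin n) → ASet (Fin n) → Set
Spurious Π A Î =
  IsAnswerSet (omit Π A) Î ×
  ¬ (Σ (ASet _) λ I → IsAnswerSet Π I × (restrict I A ≐ Î))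

IsPutBack : {n : ℕ} → Program n → ASet (Fin n) → ASet (Fin n) → ASet (Fin n) → Set
IsPutBack Π A Î PB =
  PB ⊆ˢ A ×
  ¬ (Σ (ASet _) λ Ĵ → IsAnswerSet (omit Π (A ∖ˢ PB)) Ĵ × (restrict Ĵ A ≐ Î))

-- The core is a coarsening lemma: if B ⊆ C and I is an answer set of
-- omit(Π, B), then I ∖ C is an answer set of omit(Π, C).  Take
-- B = A ∖ (PB ∪ A') and C = A ∖ PB.  An answer set Î' of omit(Π, B) with
-- Î'|Ā = Î would give the answer set Î' ∖ C of omit(Π, A ∖ PB), whose
-- restriction to Ā is again Î, contradicting that PB is a put-back set.
--
-- Answer sets are defined (in Defs) through the expansion of choice rules
-- with fresh atoms, numbered by rule position; these positions shift under
-- omit.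

module Submission where

open import Defs
open import Data.Nat using (ℕ; zero; suc; _+_)
open import Data.Nat.Properties using (+-identityʳ; +-suc)
open import Data.Fin using (Fin)
open import Data.Bool using (Bool; true; false; T; not; _∧_)
open import Data.Bool.Properties using (T-∧; T-∨; T-not-≡; ∧-identityʳ; ∧-zeroʳ)
open import Data.Unit using (⊤; tt)
open import Data.Empty using (⊥-elim)
open import Data.Maybe using (just; nothing)
open import Data.List using (List; []; _∷_; _++_; map; fromMaybe)
open import Data.List.Relation.Unary.All as All using (All; []; _∷_; all?)
open import Data.List.Relation.Unary.All.Properties using (++⁻; ++⁺; map⁺; map⁻)
open import Data.List.Relation.Unary.Any using (here; there)
open import Data.List.Membership.Propositional using (_∈_)
open import Data.List.Membership.Propositional.Properties
  using (∈-filter⁻; ∈-filter⁺; ∈-++⁺ˡ; ∈-++⁺ʳ; ∈-concat⁻′; ∈-concat⁺′; ∈-map⁺; ∈-map⁻)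
open import Data.Sum using (_⊎_; inj₁; inj₂)
open import Data.Product using (∃; _×_; _,_; proj₁; proj₂)
open import Function.Bundles using (Equivalence)
open import Relation.Nullary using (¬_; Dec)
open import Relation.Nullary.Decidable using (T?; ¬?; _×-dec_; isYes; toWitness; fromWitness; decidable-stable)
open import Relation.Binary.PropositionalEquality using (_≡_; refl; sym; trans; cong; subst)

open Equivalence using (to; from)

variable
  n : ℕ
  Atom : Set

_∉ˢ_ : Atom → ASet Atom → Set
a ∉ˢ S = S a ≡ false

_∩ˢ_ : ASet Atom → ASet Atom → ASet Atom
(S ∩ˢ S') a = S a ∧ S' a

∉⇒¬∈ : {S : ASet Atom} (a : Atom) → a ∉ˢ S → ¬ (a ∈ˢ S)
∉⇒¬∈ a a∉S a∈S = subst T a∉S a∈S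

⊆⇒∉ : {S S' : ASet Atom} → S ⊆ˢ S' → (a : Atom) → a ∉ˢ S' → a ∉ˢ S
⊆⇒∉ {S = S} {S'} S⊆S' a a∉S' with S a in e
... | false = refl
... | true  = ⊥-elim (∉⇒¬∈ {S = S'} a a∉S' (S⊆S' a (subst T (sym e) tt)))

∈-∖ˢ⁺ : {S S' : ASet Atom} (a : Atom) → a ∈ˢ S → a ∉ˢ S' → a ∈ˢ (S ∖ˢ S')
∈-∖ˢ⁺ {S = S} {S'} a a∈S a∉S' =
  from (T-∧ {S a} {not (S' a)}) (a∈S , from (T-not-≡ {S' a}) a∉S')

∈-∖ˢ⁻ : {S S' : ASet Atom} (a : Atom) → a ∈ˢ (S ∖ˢ S') → a ∈ˢ S × a ∉ˢ S'
∈-∖ˢ⁻ {S = S} {S'} a a∈ =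
  let (a∈S , a∉S') = to (T-∧ {S a} {not (S' a)}) a∈ in a∈S , to (T-not-≡ {S' a}) a∉S'

∖ˢ-outside : (S S' : ASet Atom) (a : Atom) → a ∉ˢ S' → (S ∖ˢ S') a ≡ S a
∖ˢ-outside S S' a a∉S' rewrite a∉S' = ∧-identityʳ (S a)

∈-∩ˢ⁻ : {S S' : ASet Atom} (a : Atom) → a ∈ˢ (S ∩ˢ S') → a ∈ˢ S × a ∈ˢ S'
∈-∩ˢ⁻ {S = S} {S'} a = to (T-∧ {S a} {S' a})

∈-∪ˢ⁻ : {S S' : ASet Atom} (a : Atom) → a ∈ˢ (S ∪ˢ S') → a ∈ˢ S ⊎ a ∈ˢ S'
∈-∪ˢ⁻ {S = S} {S'} a = to (T-∨ {S a} {S' a})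

⊆-∪ˢˡ : {S S' : ASet Atom} → S ⊆ˢ (S ∪ˢ S')
⊆-∪ˢˡ {S = S} {S'} a a∈S = from (T-∨ {S a} {S' a}) (inj₁ a∈S)

⊆-antisym : {S S' : ASet Atom} → S ⊆ˢ S' → S' ⊆ˢ S → S ≐ S'
⊆-antisym {S = S} {S'} S⊆S' S'⊆S a with S a in e | S' a in e'
... | true  | true  = refl
... | false | false = refl
... | true  | false = ⊥-elim (∉⇒¬∈ {S = S'} a e' (S⊆S' a (subst T (sym e) tt)))
... | false | true  = ⊥-elim (∉⇒¬∈ {S = S} a e (S'⊆S a (subst T (sym e') tt)))

∖ˢ-antitone : {S S₁ S₂ : ASet Atom} → S₁ ⊆ˢ S₂ → (S ∖ˢ S₂) ⊆ˢ (S ∖ˢ S₁)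
∖ˢ-antitone {S = S} {S₁} {S₂} S₁⊆S₂ a a∈ =
  let (a∈S , a∉S₂) = ∈-∖ˢ⁻ {S = S} {S₂} a a∈
  in ∈-∖ˢ⁺ {S = S} {S₁} a a∈S (⊆⇒∉ S₁⊆S₂ a a∉S₂)

restrict-∖ˢ : {I A C : ASet Atom} → C ⊆ˢ A → restrict (I ∖ˢ C) A ≐ restrict I A
restrict-∖ˢ {I = I} {A} {C} C⊆A a with A a in eA
... | true  = trans (∧-zeroʳ ((I ∖ˢ C) a)) (sym (∧-zeroʳ (I a)))
... | false = cong (_∧ true) (∖ˢ-outside I C a (⊆⇒∉ C⊆A a eA))

-- For an I satisfying P, the FLP
-- condition on the reduct {r ∈ P | I ⊨ B(r)} is equivalent to closedness
-- of J ⊆ I under each rule relative to I; for a choice rule this says that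
-- a chosen head with true body must stay chosen (see the equivalence with
-- the expansion below).

Body : ASet Atom → List Atom → List Atom → Set
Body K p q = All (λ a → a ∈ˢ K) p × All (λ a → ¬ (a ∈ˢ K)) q

core : Rule n → NRule (Fin n)
core (normal (atom a) p q) = mkN (just a) p q
core (normal bot p q)      = mkN nothing p q
core (choice a p q)        = mkN (just a) p q

atoms : Rule n → List (Fin n)
atoms r = fromMaybe (head (core r)) ++ pos (core r) ++ neg (core r)

Satisfies : ASet (Fin n) → Rule n → Set
Satisfies I (normal h p q) = SatRule I (core (normal h p q))
Satisfies I (choice _ _ _) = ⊤

Closed : ASet (Fin n) → ASet (Fin n) → Rule n → Set
Closed I J r =
  BodyTrue I (core r) → BodyTrue J (core r) →
  HeadTrue I (head (core r)) → HeadTrue J (head (core r))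

DirectAnswerSet : Program n → ASet (Fin n) → Set
DirectAnswerSet P I =
  All (Satisfies I) P × (∀ J → J ⊆ˢ I → All (Closed I J) P → I ⊆ˢ J)

body-agree : {K K' : ASet Atom} (p q : List Atom) →
  (∀ {a} → a ∈ p ++ q → K a ≡ K' a) → Body K p q → Body K' p q
body-agree p q agree (bp , bq) =
  All.tabulate (λ m → subst T (agree (∈-++⁺ˡ m)) (All.lookup bp m)) ,
  All.tabulate (λ m t → All.lookup bq m (subst T (sym (agree (∈-++⁺ʳ p m))) t))

satisfies-local : {I I' : ASet (Fin n)} (r : Rule n) →
  (∀ {a} → a ∈ atoms r → I a ≡ I' a) → Satisfies I r → Satisfies I' r
satisfies-local (normal (atom h) p q) agree sat b =
  subst T (agree (here refl)) (sat (body-agree p q (λ m → sym (agree (there m))) b))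
satisfies-local (normal bot p q) agree sat b = sat (body-agree p q (λ m → sym (agree m)) b)
satisfies-local (choice _ _ _) _ _ = tt

anyIn-false⁻ : (A : ASet (Fin n)) {xs : List (Fin n)} {a : Fin n} →
  anyIn A xs ≡ false → a ∈ xs → a ∉ˢ A
anyIn-false⁻ A {x ∷ xs} none m with A x in ex
anyIn-false⁻ A {x ∷ xs} () m          | true
anyIn-false⁻ A {x ∷ xs} none (here refl) | false = ex
anyIn-false⁻ A {x ∷ xs} none (there m)   | false = anyIn-false⁻ A none m

anyIn-false⁺ : (A : ASet (Fin n)) {xs : List (Fin n)} →
  (∀ {a} → a ∈ xs → a ∉ˢ A) → anyIn A xs ≡ false
anyIn-false⁺ A {[]} outside = refl
anyIn-false⁺ A {x ∷ xs} outside rewrite outside (here refl) =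
  anyIn-false⁺ A (λ m → outside (there m))

record Without (A : ASet Atom) (xs ys : List Atom) : Set where
  field
    sound    : ∀ {a} → a ∈ ys → a ∈ xs × a ∉ˢ A
    complete : ∀ {a} → a ∈ xs → a ∉ˢ A → a ∈ ys
open Without

without-drop : (A : ASet (Fin n)) (xs : List (Fin n)) → Without A xs (drop A xs)
without-drop A xs = record
  { sound    = λ {a} m → let (m' , out) = ∈-filter⁻ keep {xs = xs} m
                         in m' , to (T-not-≡ {A a}) out
  ; complete = λ {a} m out → ∈-filter⁺ keep m (from (T-not-≡ {A a}) out)
  }
  where keep = λ a → T? (not (A a))

without-self : {A : ASet Atom} {xs : List Atom} →
  (∀ {a} → a ∈ xs → a ∉ˢ A) → Without A xs xs
without-self outside = record { sound = λ m → m , outside m ; complete = λ m _ → m }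

without-refine : {B C : ASet Atom} {xs ys zs : List Atom} → B ⊆ˢ C →
  Without B xs ys → Without C xs zs → ∀ {a} → a ∈ zs → a ∈ ys × a ∉ˢ C
without-refine B⊆C wB wC m =
  let (m' , out) = sound wC m in complete wB m' (⊆⇒∉ B⊆C _ out) , out

record Abstracts (A : ASet (Fin n)) (r r' : Rule n) : Set where
  field
    same-head   : head (core r') ≡ head (core r)
    pos-without : Without A (pos (core r)) (pos (core r'))
    neg-without : Without A (neg (core r)) (neg (core r'))
open Abstracts

abstracts-self : {A : ASet (Fin n)} (r : Rule n) →
  anyIn A (pos (core r) ++ neg (core r)) ≡ false → Abstracts A r r
abstracts-self {A = A} r none = record
  { same-head   = refl
  ; pos-without = without-self (λ m → anyIn-false⁻ A none (∈-++⁺ˡ m))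
  ; neg-without = without-self (λ m → anyIn-false⁻ A none (∈-++⁺ʳ (pos (core r)) m))
  }

abstracts-relax : {A : ASet (Fin n)} (r : Rule n) {h : Fin n} → head (core r) ≡ just h →
  Abstracts A r (choice h (drop A (pos (core r))) (drop A (neg (core r))))
abstracts-relax {A = A} r eh = record
  { same-head   = sym eh
  ; pos-without = without-drop A (pos (core r))
  ; neg-without = without-drop A (neg (core r))
  }

omitRule-abstracts : {A : ASet (Fin n)} (r : Rule n) {r' : Rule n} →
  r' ∈ omitRule r A → Abstracts A r r'
omitRule-abstracts {A = A} r@(normal bot p q) m with anyIn A (p ++ q) in none
omitRule-abstracts r@(normal bot p q) (here refl) | false = abstracts-self r none
omitRule-abstracts {A = A} r@(normal (atom h) p q) m with A h | anyIn A (p ++ q) in touched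
omitRule-abstracts r@(normal (atom h) p q) (here refl) | false | false = abstracts-self r touched
omitRule-abstracts r@(normal (atom h) p q) (here refl) | false | true  = abstracts-relax r refl
omitRule-abstracts {A = A} r@(choice h p q) m with A h | anyIn A (p ++ q) in touched
omitRule-abstracts r@(choice h p q) (here refl) | false | false = abstracts-self r touched
omitRule-abstracts r@(choice h p q) (here refl) | false | true  = abstracts-relax r refl

omitRule-covers : {A : ASet (Fin n)} (r : Rule n) {h : Fin n} →
  head (core r) ≡ just h → h ∉ˢ A → ∃ λ r' → r' ∈ omitRule r A
omitRule-covers {A = A} (normal (atom h) p q) refl h∉A rewrite h∉A with anyIn A (p ++ q)
... | false = _ , here refl
... | true  = _ , here refl
omitRule-covers {A = A} (choice h p q) refl h∉A rewrite h∉A with anyIn A (p ++ q)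
... | false = _ , here refl
... | true  = _ , here refl

Untouched : ASet (Fin n) → Rule n → Set
Untouched A r = ∀ {a} → a ∈ atoms r → a ∉ˢ A

omitRule-normal : {A : ASet (Fin n)} (r : Rule n) {h : Head n} {p q : List (Fin n)} →
  normal h p q ∈ omitRule r A → r ≡ normal h p q × Untouched A r
omitRule-normal {A = A} (normal bot p q) m with anyIn A (p ++ q) in none
omitRule-normal (normal bot p q) (here refl) | false = refl , anyIn-false⁻ _ none
omitRule-normal {A = A} (normal (atom h) p q) m with A h in eh | anyIn A (p ++ q) in none
omitRule-normal (normal (atom h) p q) (here refl) | false | false =
  refl , λ { (here refl) → eh ; (there m) → anyIn-false⁻ _ none m }
omitRule-normal (normal (atom h) p q) (here ()) | false | true
omitRule-normal {A = A} (choice h p q) m with A h | anyIn A (p ++ q)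
omitRule-normal (choice h p q) (here ()) | false | false
omitRule-normal (choice h p q) (here ()) | false | true

omitRule-untouched : {A : ASet (Fin n)} (r : Rule n) → Untouched A r → r ∈ omitRule r A
omitRule-untouched {A = A} (normal bot p q) out rewrite anyIn-false⁺ A out = here refl
omitRule-untouched {A = A} (normal (atom h) p q) out
  rewrite out (here refl) | anyIn-false⁺ A (λ m → out (there m)) = here refl
omitRule-untouched {A = A} (choice h p q) out
  rewrite out (here refl) | anyIn-false⁺ A (λ m → out (there m)) = here refl

∈-omit⁻ : {A : ASet (Fin n)} (Π : Program n) {r' : Rule n} →
  r' ∈ omit Π A → ∃ λ r → r ∈ Π × r' ∈ omitRule r A
∈-omit⁻ {A = A} Π m =
  let (rs , m' , rs∈) = ∈-concat⁻′ (map (λ r → omitRule r A) Π) m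
      (r , r∈Π , rs≡) = ∈-map⁻ (λ r → omitRule r A) rs∈
  in r , r∈Π , subst (_ ∈_) rs≡ m'

∈-omit⁺ : {A : ASet (Fin n)} {Π : Program n} {r r' : Rule n} →
  r ∈ Π → r' ∈ omitRule r A → r' ∈ omit Π A
∈-omit⁺ {A = A} r∈Π m = ∈-concat⁺′ m (∈-map⁺ (λ r → omitRule r A) r∈Π)

refine-body : {B C K K' : ASet (Fin n)} {r r'' r' : Rule n} → B ⊆ˢ C →
  Abstracts B r r'' → Abstracts C r r' →
  (∀ a → a ∉ˢ C → a ∈ˢ K → a ∈ˢ K') → (∀ a → ¬ (a ∈ˢ K) → ¬ (a ∈ˢ K')) →
  BodyTrue K (core r'') → BodyTrue K' (core r')
refine-body B⊆C absB absC pos⇒ neg⇒ (bp , bq) =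
  All.tabulate (λ m → let (m' , out) = pos-refine m in pos⇒ _ out (All.lookup bp m')) ,
  All.tabulate (λ m → neg⇒ _ (All.lookup bq (proj₁ (neg-refine m))))
  where
    pos-refine = without-refine B⊆C (pos-without absB) (pos-without absC)
    neg-refine = without-refine B⊆C (neg-without absB) (neg-without absC)

module Coarsening {B C : ASet (Fin n)} (B⊆C : B ⊆ˢ C) (I : ASet (Fin n)) where

  Î : ASet (Fin n)
  Î = I ∖ˢ C

  ∈Î⁺ : ∀ a → a ∈ˢ I → a ∉ˢ C → a ∈ˢ Î
  ∈Î⁺ = ∈-∖ˢ⁺ {S = I} {C}

  ∈Î⁻ : ∀ a → a ∈ˢ Î → a ∈ˢ I × a ∉ˢ C
  ∈Î⁻ = ∈-∖ˢ⁻ {S = I} {C}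

  satisfies : (Π : Program n) → All (Satisfies I) (omit Π B) → All (Satisfies Î) (omit Π C)
  satisfies Π sat = All.tabulate (λ {r'} → satisfies-rule r')
    where
      -- a normal rule of omit(Π, C) is an original rule not touching C,
      -- hence also a rule of omit(Π, B), on whose atoms I and Î agree
      satisfies-rule : ∀ r' → r' ∈ omit Π C → Satisfies Î r'
      satisfies-rule (choice _ _ _) _ = tt
      satisfies-rule (normal h p q) m with ∈-omit⁻ Π m
      ... | r , r∈Π , m' with omitRule-normal r m'
      ... | refl , untouched =
        satisfies-local r (λ a∈ → sym (∖ˢ-outside I C _ (untouched a∈)))
          (All.lookup sat (∈-omit⁺ r∈Π (omitRule-untouched r (λ a∈ → ⊆⇒∉ B⊆C _ (untouched a∈)))))

  extend : ASet (Fin n) → ASet (Fin n)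
  extend J = J ∪ˢ (I ∩ˢ C)

  extend-outside : ∀ J a → a ∉ˢ C → a ∈ˢ extend J → a ∈ˢ J
  extend-outside J a a∉C a∈ with ∈-∪ˢ⁻ {S = J} {I ∩ˢ C} a a∈
  ... | inj₁ a∈J   = a∈J
  ... | inj₂ a∈I∩C = ⊥-elim (∉⇒¬∈ {S = C} a a∉C (proj₂ (∈-∩ˢ⁻ {S = I} {C} a a∈I∩C)))

  extend-⊆ : ∀ J → J ⊆ˢ Î → extend J ⊆ˢ I
  extend-⊆ J J⊆Î a a∈ with ∈-∪ˢ⁻ {S = J} {I ∩ˢ C} a a∈
  ... | inj₁ a∈J   = proj₁ (∈Î⁻ a (J⊆Î a a∈J))
  ... | inj₂ a∈I∩C = proj₁ (∈-∩ˢ⁻ {S = I} {C} a a∈I∩C)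

  ∈-extend : ∀ J h → h ∈ˢ I → (h ∉ˢ C → h ∈ˢ J) → h ∈ˢ extend J
  ∈-extend J h h∈I derive with C h
  ... | true  = from (T-∨ {J h} {I h ∧ true}) (inj₂ (from (T-∧ {I h} {true}) (h∈I , tt)))
  ... | false = from (T-∨ {J h} {I h ∧ false}) (inj₁ (derive refl))

  -- A head h ∈ C of a rule of omit(Π, B) is in extend J because h ∈ I; a
  -- head h ∉ C is derived in J by the abstraction of the same original
  -- rule in omit(Π, C).
  closed-rule : ∀ J r {r''} → r'' ∈ omitRule r B →
    (∀ {r'} → r' ∈ omitRule r C → Closed Î J r') → Closed I (extend J) r''
  closed-rule J r {r''} m closedC bI bK hI with head (core r'') in eh
  ... | just h = ∈-extend J h hI derive
    where
      absB = omitRule-abstracts r m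
      h-in-r = trans (sym (same-head absB)) eh
      derive : h ∉ˢ C → h ∈ˢ J
      derive h∉C =
        subst (λ x → HeadTrue Î x → HeadTrue J x) h-in-r' (closedC m' bÎ bJ) (∈Î⁺ h hI h∉C)
        where
          m' = proj₂ (omitRule-covers r h-in-r h∉C)
          absC = omitRule-abstracts r m'
          h-in-r' = trans (same-head absC) h-in-r
          bÎ = refine-body B⊆C absB absC (λ a a∉C a∈I → ∈Î⁺ a a∈I a∉C)
                                         (λ a a∉I a∈Î → a∉I (proj₁ (∈Î⁻ a a∈Î))) bI
          bJ = refine-body B⊆C absB absC (extend-outside J)
                                         (λ a a∉K a∈J → a∉K (⊆-∪ˢˡ {S = J} {I ∩ˢ C} a a∈J)) bK

  closed : (Π : Program n) (J : ASet (Fin n)) →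
    All (Closed Î J) (omit Π C) → All (Closed I (extend J)) (omit Π B)
  closed Π J closedC = All.tabulate λ m →
    let (r , r∈Π , m') = ∈-omit⁻ Π m
    in closed-rule J r m' (λ m'' → All.lookup closedC (∈-omit⁺ r∈Π m''))

  -- the coarsening lemma: minimality of I transfers to Î through extend
  coarsen : (Π : Program n) → DirectAnswerSet (omit Π B) I → DirectAnswerSet (omit Π C) Î
  coarsen Π (sat , least) = satisfies Π sat , least'
    where
      least' : ∀ J → J ⊆ˢ Î → All (Closed Î J) (omit Π C) → Î ⊆ˢ J
      least' J J⊆Î closedJ a a∈Î =
        let (a∈I , a∉C) = ∈Î⁻ a a∈Î
        in extend-outside J a a∉C (least (extend J) (extend-⊆ J J⊆Î) (closed Π J closedJ) a a∈I)

-- Native answer sets coincide with answer sets of the expansion: the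
-- original part of an answer set of the expansion is a native answer set,
-- and a native answer set becomes an answer set of the expansion when each
-- fresh atom ᾱ of a choice rule {α} ← B is made true exactly when B holds
-- and α does not.

Extends : ASet (XAtom n) → ASet (Fin n) → Set
Extends Y K = ∀ a → Y (inj₁ a) ≡ K a

body-inj₁⁺ : {Y : ASet (XAtom n)} {K : ASet (Fin n)} {p q : List (Fin n)} →
  Extends Y K → Body K p q → Body Y (map inj₁ p) (map inj₁ q)
body-inj₁⁺ ext (bp , bq) =
  map⁺ (All.map (λ {a} t → subst T (sym (ext a)) t) bp) ,
  map⁺ (All.map (λ {a} f t → f (subst T (ext a) t)) bq)

body-inj₁⁻ : {Y : ASet (XAtom n)} {K : ASet (Fin n)} {p q : List (Fin n)} →
  Extends Y K → Body Y (map inj₁ p) (map inj₁ q) → Body K p q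
body-inj₁⁻ ext (bp , bq) =
  All.map (λ {a} t → subst T (ext a) t) (map⁻ bp) ,
  All.map (λ {a} f t → f (subst T (sym (ext a)) t)) (map⁻ bq)

overlay : ASet (Fin n) → ASet (XAtom n) → ASet (XAtom n)
overlay J Y (inj₁ a) = J a
overlay J Y (inj₂ k) = Y (inj₂ k)

module FromExpansion {X : ASet (XAtom n)} {I : ASet (Fin n)} (ext : Extends X I) where

  satisfies-rule : ∀ i r → FLPReductModel X X (expandRule i r) → Satisfies I r
  satisfies-rule i (normal (atom h) p q) (m ∷ []) b =
    let bX = body-inj₁⁺ ext b in subst T (ext h) (m bX bX)
  satisfies-rule i (normal bot p q) (m ∷ []) b =
    let bX = body-inj₁⁺ ext b in m bX bX
  satisfies-rule i (choice _ _ _) _ = tt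

  closed-rule : ∀ J i r → FLPReductModel X X (expandRule i r) →
    Closed I J r → FLPReductModel X (overlay J X) (expandRule i r)
  closed-rule J i (normal (atom h) p q) (m ∷ []) closed =
    (λ bX bJ → closed (body-inj₁⁻ ext bX) (body-inj₁⁻ (λ _ → refl) bJ) (subst T (ext h) (m bX bX)))
    ∷ []
  closed-rule J i (normal bot p q) (m ∷ []) closed = (λ bX _ → m bX bX) ∷ []
  closed-rule J i (choice h p q) (m₁ ∷ m₂ ∷ []) closed =
    (λ { bX@(bp , _ ∷ bq) (bp' , _ ∷ bq') →
         closed (body-inj₁⁻ ext (bp , bq)) (body-inj₁⁻ (λ _ → refl) (bp' , bq'))
                (subst T (ext h) (m₁ bX bX)) })
    ∷ (λ bX _ → m₂ bX bX) ∷ []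

  satisfies : ∀ i P → FLPReductModel X X (expandFrom i P) → All (Satisfies I) P
  satisfies i [] _ = []
  satisfies i (r ∷ P) model =
    let (model-r , model-P) = ++⁻ (expandRule i r) model
    in satisfies-rule i r model-r ∷ satisfies (suc i) P model-P

  closed : ∀ J i P → FLPReductModel X X (expandFrom i P) →
    All (Closed I J) P → FLPReductModel X (overlay J X) (expandFrom i P)
  closed J i [] _ [] = []
  closed J i (r ∷ P) model (closed-r ∷ closed-P) =
    let (model-r , model-P) = ++⁻ (expandRule i r) model
    in ++⁺ (closed-rule J i r model-r closed-r) (closed J (suc i) P model-P closed-P)

answerSet⇒direct : {P : Program n} {I : ASet (Fin n)} → IsAnswerSet P I → DirectAnswerSet P I
answerSet⇒direct {P = P} {I} (X , (model , minimal) , ext) = satisfies 0 P model , least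
  where
    open FromExpansion {X = X} ext
    least : ∀ J → J ⊆ˢ I → All (Closed I J) P → I ⊆ˢ J
    least J J⊆I closedJ a a∈I =
      minimal (overlay J X) overlay-⊆ (closed J 0 P model closedJ) (inj₁ a) (subst T (sym (ext a)) a∈I)
      where
        overlay-⊆ : overlay J X ⊆ˢ X
        overlay-⊆ (inj₁ b) b∈J = subst T (sym (ext b)) (J⊆I b b∈J)
        overlay-⊆ (inj₂ k) k∈X = k∈X

body? : (K : ASet Atom) (p q : List Atom) → Dec (Body K p q)
body? K p q = all? (λ a → T? (K a)) p ×-dec all? (λ a → ¬? (T? (K a))) q

blocked : ASet (Fin n) → Rule n → Bool
blocked I (normal _ _ _) = false
blocked I (choice h p q) = isYes (body? I p q ×-dec ¬? (T? (I h)))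

blocked⁺ : {I : ASet (Fin n)} {h : Fin n} {p q : List (Fin n)} →
  Body I p q → ¬ (h ∈ˢ I) → T (blocked I (choice h p q))
blocked⁺ b h∉I = fromWitness (b , h∉I)

blocked⁻ : {I : ASet (Fin n)} {h : Fin n} {p q : List (Fin n)} →
  T (blocked I (choice h p q)) → Body I p q × ¬ (h ∈ˢ I)
blocked⁻ = toWitness

-- the k-th fresh atom belongs to the k-th rule of P
freshValue : ASet (Fin n) → Program n → ℕ → Bool
freshValue I []      k       = false
freshValue I (r ∷ P) zero    = blocked I r
freshValue I (r ∷ P) (suc k) = freshValue I P k

extension : ASet (Fin n) → Program n → ASet (XAtom n)
extension I P (inj₁ a) = I a
extension I P (inj₂ k) = freshValue I P k

base : ASet (XAtom n) → ASet (Fin n)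
base Y a = Y (inj₁ a)

module ToExpansion {X : ASet (XAtom n)} {I : ASet (Fin n)} (ext : Extends X I) where

  FreshFrom : ℕ → Program n → Set
  FreshFrom i P = ∀ k → X (inj₂ (i + k)) ≡ freshValue I P k

  fresh-here : ∀ {i r P} → FreshFrom i (r ∷ P) → X (inj₂ i) ≡ blocked I r
  fresh-here {i} f = trans (cong (λ j → X (inj₂ j)) (sym (+-identityʳ i))) (f 0)

  fresh-next : ∀ {i r P} → FreshFrom i (r ∷ P) → FreshFrom (suc i) P
  fresh-next {i} f k = trans (cong (λ j → X (inj₂ j)) (sym (+-suc i k))) (f (suc k))

  choice-head : ∀ {i h p q} → X (inj₂ i) ≡ blocked I (choice h p q) →
    Body I p q → ¬ T (X (inj₂ i)) → h ∈ˢ I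
  choice-head {h = h} fresh b ᾱ∉X =
    decidable-stable (T? (I h)) (λ h∉I → ᾱ∉X (subst T (sym fresh) (blocked⁺ b h∉I)))

  model-rule : ∀ i r → X (inj₂ i) ≡ blocked I r → Satisfies I r →
    FLPReductModel X X (expandRule i r)
  model-rule i (normal (atom h) p q) _ sat =
    (λ bX _ → subst T (sym (ext h)) (sat (body-inj₁⁻ ext bX))) ∷ []
  model-rule i (normal bot p q) _ sat = (λ bX _ → sat (body-inj₁⁻ ext bX)) ∷ []
  model-rule i (choice h p q) fresh _ =
    (λ { (bp , ᾱ∉X ∷ bq) _ →
         subst T (sym (ext h)) (choice-head fresh (body-inj₁⁻ ext (bp , bq)) ᾱ∉X) })
    ∷ (λ bX _ → let (bp , h∉I∷bq) = body-inj₁⁻ {q = h ∷ q} ext bX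
                in subst T (sym fresh) (blocked⁺ (bp , All.tail h∉I∷bq) (All.head h∉I∷bq)))
    ∷ []

  closed-rule : ∀ {Y} i r → X (inj₂ i) ≡ blocked I r → Y ⊆ˢ X →
    FLPReductModel X Y (expandRule i r) → Closed I (base Y) r
  closed-rule i (normal (atom h) p q) _ _ (m ∷ []) bI bY _ =
    m (body-inj₁⁺ ext bI) (body-inj₁⁺ (λ _ → refl) bY)
  closed-rule i (normal bot p q) _ _ _ _ _ ()
  closed-rule i (choice h p q) fresh Y⊆X (m₁ ∷ _) bI bY h∈I =
    m₁ (bp , ᾱ∉X ∷ bq) (bp' , (λ t → ᾱ∉X (Y⊆X _ t)) ∷ bq')
    where
      ᾱ∉X : ¬ T (X (inj₂ i))
      ᾱ∉X t = proj₂ (blocked⁻ (subst T fresh t)) h∈I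
      bX = body-inj₁⁺ ext bI
      bp = proj₁ bX
      bq = proj₂ bX
      bY' = body-inj₁⁺ (λ _ → refl) bY
      bp' = proj₁ bY'
      bq' = proj₂ bY'

  fresh-rule : ∀ {Y} i r → Extends Y I → FLPReductModel X Y (expandRule i r) →
    T (blocked I r) → T (Y (inj₂ i))
  fresh-rule i (normal _ _ _) _ _ ()
  fresh-rule i (choice h p q) extY (_ ∷ m₂ ∷ []) t =
    let ((bp , bq) , h∉I) = blocked⁻ t
    in m₂ (body-inj₁⁺ {q = h ∷ q} ext (bp , h∉I ∷ bq)) (body-inj₁⁺ {q = h ∷ q} extY (bp , h∉I ∷ bq))

  model : ∀ i P → FreshFrom i P → All (Satisfies I) P → FLPReductModel X X (expandFrom i P)
  model i [] _ [] = []
  model i (r ∷ P) f (sat-r ∷ sat-P) =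
    ++⁺ (model-rule i r (fresh-here f) sat-r) (model (suc i) P (fresh-next f) sat-P)

  closed : ∀ {Y} i P → FreshFrom i P → Y ⊆ˢ X →
    FLPReductModel X Y (expandFrom i P) → All (Closed I (base Y)) P
  closed i [] _ _ _ = []
  closed i (r ∷ P) f Y⊆X reduct =
    let (reduct-r , reduct-P) = ++⁻ (expandRule i r) reduct
    in closed-rule i r (fresh-here f) Y⊆X reduct-r ∷ closed (suc i) P (fresh-next f) Y⊆X reduct-P

  fresh : ∀ {Y} i P → Extends Y I → FLPReductModel X Y (expandFrom i P) →
    ∀ k → T (freshValue I P k) → T (Y (inj₂ (i + k)))
  fresh i [] _ _ k ()
  fresh {Y} i (r ∷ P) extY reduct zero t =
    subst (λ j → T (Y (inj₂ j))) (sym (+-identityʳ i))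
      (fresh-rule i r extY (proj₁ (++⁻ (expandRule i r) reduct)) t)
  fresh {Y} i (r ∷ P) extY reduct (suc k) t =
    subst (λ j → T (Y (inj₂ j))) (sym (+-suc i k))
      (fresh (suc i) P extY (proj₂ (++⁻ (expandRule i r) reduct)) k t)

direct⇒answerSet : {P : Program n} {I : ASet (Fin n)} → DirectAnswerSet P I → IsAnswerSet P I
direct⇒answerSet {P = P} {I} (sat , least) =
  extension I P , (model 0 P fresh₀ sat , minimal) , λ _ → refl
  where
    open ToExpansion {X = extension I P} (λ _ → refl)
    fresh₀ : FreshFrom 0 P
    fresh₀ k = refl
    minimal : ∀ Y → Y ⊆ˢ extension I P → FLPReductModel (extension I P) Y (expand P) →
      extension I P ⊆ˢ Y
    minimal Y Y⊆X reduct = X⊆Y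
      where
        I⊆Y : I ⊆ˢ base Y
        I⊆Y = least (base Y) (λ a → Y⊆X (inj₁ a)) (closed 0 P fresh₀ Y⊆X reduct)
        X⊆Y : extension I P ⊆ˢ Y
        X⊆Y (inj₁ a) = I⊆Y a
        X⊆Y (inj₂ k) = fresh 0 P (⊆-antisym (λ a → Y⊆X (inj₁ a)) I⊆Y) reduct k

-- Answer sets of a finer abstraction coarsen to answer sets of
-- omit(Π, A ∖ PB) with the same restriction to Ā, so none restricts to Î.
proposition8 : (n : ℕ) (Π : Program n) (A Î PB : ASet (Fin n)) →
    Spurious Π A Î → IsPutBack Π A Î PB →
    (A' : ASet (Fin n)) → A' ⊆ˢ (A ∖ˢ PB) →
    (Î' : ASet (Fin n)) → IsAnswerSet (omit Π (A ∖ˢ (PB ∪ˢ A'))) Î' →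
    ¬ (restrict Î' A ≐ Î)
proposition8 n Π A Î PB _ (_ , no-answer-for-Î) A' _ Î' Î'-answer Î'-restricts =
  no-answer-for-Î (Î' ∖ˢ (A ∖ˢ PB) , coarse-answer , coarse-restricts)
  where
    refines : (A ∖ˢ (PB ∪ˢ A')) ⊆ˢ (A ∖ˢ PB)
    refines = ∖ˢ-antitone {S = A} (⊆-∪ˢˡ {S = PB} {A'})

    coarse-answer : IsAnswerSet (omit Π (A ∖ˢ PB)) (Î' ∖ˢ (A ∖ˢ PB))
    coarse-answer =
      direct⇒answerSet (Coarsening.coarsen refines Î' Π (answerSet⇒direct Î'-answer))

    coarse-restricts : restrict (Î' ∖ˢ (A ∖ˢ PB)) A ≐ Î
    coarse-restricts a =
      trans (restrict-∖ˢ {I = Î'} (λ b b∈ → proj₁ (∈-∖ˢ⁻ {S = A} {PB} b b∈)) a) (Î'-restricts a)
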